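{- For all $k,q\ge 1$, the class $\mathcal{T}^k_q$ is closed under taking minors, closed under taking disjoint unions, and is a subclass of $\mathcal{TW}_{k-1}\cap\mathcal{TD}_q$.
   Context: All graphs are finite, simple and loopless. A rooted forest on $V$ induces a partial order $\preceq$ ($u\preceq v$ iff $u$ is on the path from the root of $v$'s tree to $v$); its depth is the maximum number of vertices on a root-to-leaf path. A $k$-pebble forest cover of $G$ is a rooted forest on $V(G)$ with a map $p\colon V(G)\to\{1,\dots,k\}$ such that for every edge $uv$, $u\preceq v$ or $v\preceq u$, and if $uv\in E(G)$ and $u\prec v$ then $p(u)\neq p(w)$ for all $w$ with $u\prec w\preceq v$. $\mathcal{T}^k_q$ is the class of graphs admitting a $k$-pebble forest cover of depth at most $q$. $\mathcal{TW}_{k-1}$ is the class of graphs of treewidth at most $k-1$; $\mathcal{TD}_q$ is the class of graphs of treedepth at most $q$ (treedepth = minimum depth of a rooted forest on $V(G)$ in which every edge joins $\preceq$-comparable vertices). -}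

module Defs where

open import Data.Nat using (ℕ; zero; suc; _+_; _≤_; _∸_)
open import Data.Fin using (Fin; splitAt)
open import Data.Fin.Subset using (Subset; _∈_; ∣_∣)
open import Data.Bool using (Bool; true; false)
open import Data.Maybe using (Maybe; just; nothing)
open import Data.Sum using (_⊎_; inj₁; inj₂)
open import Data.Product using (Σ; _×_; _,_; ∃; ∃-syntax; ∃₂)
open import Relation.Binary.PropositionalEquality using (_≡_; _≢_; refl)

record Graph : Set where
  field
    n      : ℕ
    adj    : Fin n → Fin n → Bool
    sym    : ∀ u v → adj u v ≡ adj v u
    irrefl : ∀ v → adj v v ≡ false
open Graph public

V : Graph → Set
V G = Fin (n G)

Edge : (G : Graph) → V G → V G → Set
Edge G u v = adj G u v ≡ true

data Walk {A : Set} (R : A → A → Set) (P : A → Set) : A → A → Set where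
  stop : ∀ {a} → P a → Walk R P a a
  step : ∀ {a b c} → P a → R a b → Walk R P b c → Walk R P a c

-- Rooted forests on Fin m, given by a parent function.
-- Anc par u v d : u is an ancestor of v, d parent-steps above v.

data Anc {m : ℕ} (par : Fin m → Maybe (Fin m)) : Fin m → Fin m → ℕ → Set where
  here  : ∀ {v} → Anc par v v 0
  there : ∀ {u v w d} → par v ≡ just w → Anc par u w d → Anc par u v (suc d)

record RootedForest (m : ℕ) : Set where
  field
    par    : Fin m → Maybe (Fin m)
    -- every vertex lies below a root (this excludes parent-cycles)
    rooted : ∀ v → ∃[ r ] (par r ≡ nothing × ∃[ d ] Anc par r v d)
open RootedForest public

_⊢_⪯_ : ∀ {m} → RootedForest m → Fin m → Fin m → Set
F ⊢ u ⪯ v = ∃[ d ] Anc (par F) u v d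

_⊢_≺_ : ∀ {m} → RootedForest m → Fin m → Fin m → Set
F ⊢ u ≺ v = (F ⊢ u ⪯ v) × u ≢ v

-- depth ≤ q : every root-to-vertex path has at most q vertices
DepthAtMost : ∀ {m} → RootedForest m → ℕ → Set
DepthAtMost F q = ∀ r v d → par F r ≡ nothing → Anc (par F) r v d → suc d ≤ q

record PebbleForestCover (k : ℕ) (G : Graph) : Set where
  field
    forest : RootedForest (n G)
    peb    : V G → Fin k
    comparable : ∀ u v → Edge G u v → (forest ⊢ u ⪯ v) ⊎ (forest ⊢ v ⪯ u)
    pebbling   : ∀ u v w → Edge G u v → forest ⊢ u ≺ v →
                 forest ⊢ u ≺ w → forest ⊢ w ⪯ v → peb u ≢ peb w
open PebbleForestCover public

𝒯 : ℕ → ℕ → Graph → Set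
𝒯 k q G = Σ (PebbleForestCover k G) λ C → DepthAtMost (forest C) q

TreedepthAtMost : ℕ → Graph → Set
TreedepthAtMost q G =
  Σ (RootedForest (n G)) λ F →
    DepthAtMost F q × (∀ u v → Edge G u v → (F ⊢ u ⪯ v) ⊎ (F ⊢ v ⪯ u))

TreeAdj : ∀ {m} → RootedForest m → Fin m → Fin m → Set
TreeAdj T s t = (par T s ≡ just t) ⊎ (par T t ≡ just s)

record TreeDecomposition (w : ℕ) (G : Graph) : Set where
  field
    m        : ℕ
    tree     : RootedForest m
    oneRoot  : ∀ r r' → par tree r ≡ nothing → par tree r' ≡ nothing → r ≡ r'
    bag      : Fin m → Subset (n G)
    covers   : ∀ v → ∃[ t ] (v ∈ bag t)
    edgesIn  : ∀ u v → Edge G u v → ∃[ t ] (u ∈ bag t × v ∈ bag t)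
    connected : ∀ v t t' → v ∈ bag t → v ∈ bag t' →
                Walk (TreeAdj tree) (λ s → v ∈ bag s) t t'
    width    : ∀ t → ∣ bag t ∣ ≤ suc w

TreewidthAtMost : ℕ → Graph → Set
TreewidthAtMost w G = TreeDecomposition w G

record _≼_ (H G : Graph) : Set where
  field
    branch   : V G → Maybe (V H)
    nonempty : ∀ h → ∃[ v ] (branch v ≡ just h)
    branchConnected : ∀ h u v → branch u ≡ just h → branch v ≡ just h →
                      Walk (Edge G) (λ x → branch x ≡ just h) u v
    edgesRealised : ∀ h h' → Edge H h h' →
                    ∃₂ λ u v → branch u ≡ just h × branch v ≡ just h' × Edge G u v

module _ {a b : ℕ} (f : Fin a → Fin a → Bool) (g : Fin b → Fin b → Bool) where
  sumAdj : Fin a ⊎ Fin b → Fin a ⊎ Fin b → Bool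
  sumAdj (inj₁ x) (inj₁ y) = f x y
  sumAdj (inj₂ x) (inj₂ y) = g x y
  sumAdj (inj₁ _) (inj₂ _) = false
  sumAdj (inj₂ _) (inj₁ _) = false

sumAdj-sym : ∀ (G H : Graph) x y →
  sumAdj (adj G) (adj H) x y ≡ sumAdj (adj G) (adj H) y x
sumAdj-sym G H (inj₁ x) (inj₁ y) = sym G x y
sumAdj-sym G H (inj₂ x) (inj₂ y) = sym H x y
sumAdj-sym G H (inj₁ _) (inj₂ _) = refl
sumAdj-sym G H (inj₂ _) (inj₁ _) = refl

sumAdj-irrefl : ∀ (G H : Graph) x → sumAdj (adj G) (adj H) x x ≡ false
sumAdj-irrefl G H (inj₁ x) = irrefl G x
sumAdj-irrefl G H (inj₂ x) = irrefl H x

_⊕_ : Graph → Graph → Graph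
G ⊕ H = record
  { n      = n G + n H
  ; adj    = λ u v → sumAdj (adj G) (adj H) (splitAt (n G) u) (splitAt (n G) v)
  ; sym    = λ u v → sumAdj-sym G H (splitAt (n G) u) (splitAt (n G) v)
  ; irrefl = λ v → sumAdj-irrefl G H (splitAt (n G) v)
  }

MinorClosed : (Graph → Set) → Set
MinorClosed C = ∀ G H → H ≼ G → C G → C H

DisjointUnionClosed : (Graph → Set) → Set
DisjointUnionClosed C = ∀ G H → C G → C H → C (G ⊕ H)

-- Forgetting the pebbles, a pebble forest cover is a treedepth decomposition. For treewidth,
-- the bag of t consists of the ancestors x ⪯ t whose pebble is not reused on the path from x
-- down to t; the vertices of one bag carry distinct pebbles, so a bag has at most k vertices,
-- and the bags containing x form a subtree rooted at x. Disjoint unions are covered by the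
-- disjoint union of the forests.
--
-- For a minor H of G with branch sets B h, every B h has a ⪯-least vertex top h (B h is
-- connected and each edge joins comparable vertices), and H is covered by the forest induced on
-- the tops, which keeps the depth. The old pebbles may clash after contraction, so pebbles for H
-- are chosen greedily from the roots down: h avoids the pebbles of the h′ above it whose branch
-- sets meet the bag of top h. These meet it in vertices other than top h, all with distinct
-- pebbles, so at most k - 1 pebbles are excluded.

module Submission where

open import Defs hiding (sym)
open import Data.Nat using (ℕ; zero; suc; _+_; _≤_; _<_; _∸_; z≤n; s≤s)
open import Data.Nat.Properties
  using (≤-refl; ≤-trans; ≤-antisym; ≤-total; <-≤-trans; <⇒≱;
         m≤m+n; m≤n+m; m+[n∸m]≡n; ∸-monoʳ-<; n<1+n)
open import Data.Nat.Induction using (<-wellFounded)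
open import Data.Fin using (Fin; zero; suc; splitAt; _↑ˡ_; _↑ʳ_) renaming (_≟_ to _≟ᶠ_)
open import Data.Fin.Properties
  using (any?; all?; injective⇒≤; <⇒notInjective; punchOut-injective; suc-injective;
         splitAt-↑ˡ; splitAt-↑ʳ; splitAt⁻¹-↑ˡ; splitAt⁻¹-↑ʳ; ↑ˡ-injective; ↑ʳ-injective)
open import Data.Fin.Subset using (Subset; inside; outside; ∣_∣; Nonempty)
  renaming (_∈_ to _∈ˢ_; ⊥ to ∅)
open import Data.Fin.Subset.Properties using (∉⊥; ∣⊥∣≡0; nonempty?)
open import Data.Vec using (_∷_; tabulate; here; there)
open import Data.Vec.Properties using (lookup∘tabulate; tabulate-cong; []=⇒lookup; lookup⇒[]=)
open import Data.Bool using (true)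
open import Data.Maybe as Maybe using (Maybe; just; nothing; maybe)
open import Data.Maybe.Properties using (just-injective) renaming (≡-dec to ≡-decᵐ)
open import Data.Sum as Sum using (_⊎_; inj₁; inj₂; [_,_]; swap)
open import Data.Product using (Σ; _×_; _,_; ∃-syntax; ∃₂; proj₁; proj₂)
open import Data.Empty using (⊥-elim)
open import Function using (_∘_; _on_)
open import Function.Bundles using (mk⇔)
open import Function.Definitions using (Injective)
open import Induction.WellFounded using (WellFounded; Acc; acc; module Subrelation)
import Relation.Binary.Construct.On as On
open import Relation.Nullary using (¬_; Dec; yes; no; does; contradiction)
open import Relation.Nullary.Decidable using (_×-dec_; _→-dec_; ¬?; dec-true; does-⇔; decidable-stable)
open import Relation.Unary using (Decidable)
open import Relation.Binary.PropositionalEquality using (_≡_; _≢_; refl; sym; trans; cong; subst)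

module _ {A : Set} {R : A → A → Set} {P : A → Set} where

  walk-last : ∀ {a b} → Walk R P a b → P b
  walk-last (stop pb)    = pb
  walk-last (step _ _ w) = walk-last w

  walk-++ : ∀ {a b c} → Walk R P a b → Walk R P b c → Walk R P a c
  walk-++ (stop _)      w′ = w′
  walk-++ (step pa r w) w′ = step pa r (walk-++ w w′)

  walk-snoc : ∀ {a b c} → Walk R P a b → R b c → P c → Walk R P a c
  walk-snoc w r pc = walk-++ w (step (walk-last w) r (stop pc))

  walk-reverse : (∀ {x y} → R x y → R y x) → ∀ {a b} → Walk R P a b → Walk R P b a
  walk-reverse R-sym (stop pa)     = stop pa
  walk-reverse R-sym (step pa r w) = walk-snoc (walk-reverse R-sym w) (R-sym r) pa

walk-weaken : ∀ {A : Set} {R : A → A → Set} {P Q : A → Set} →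
              (∀ {x} → P x → Q x) → ∀ {a b} → Walk R P a b → Walk R Q a b
walk-weaken P⇒Q (stop pa)     = stop (P⇒Q pa)
walk-weaken P⇒Q (step pa r w) = step (P⇒Q pa) r (walk-weaken P⇒Q w)

module _ {m : ℕ} {R : Fin m → Fin m → Set} (R-wf : WellFounded R) (R? : ∀ x y → Dec (R x y))
         {P : Fin m → Set} (P? : Decidable P) where

  minimal : ∀ {a} → P a → ∃[ t ] (P t × ∀ x → P x → ¬ R x t)
  minimal {a} = search (R-wf a)
    where
    search : ∀ {a} → Acc R a → P a → ∃[ t ] (P t × ∀ x → P x → ¬ R x t)
    search {a} (acc rs) pa with any? (λ x → P? x ×-dec R? x a)
    ... | yes (x , px , xRa) = search (rs xRa) px
    ... | no  none           = a , pa , λ x px xRa → none (x , px , xRa)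

measure-wellFounded : ∀ {A : Set} {R : A → A → Set} (f : A → ℕ) →
                      (∀ {x y} → R x y → f x < f y) → WellFounded R
measure-wellFounded f R⇒< = Subrelation.wellFounded R⇒< (On.wellFounded f <-wellFounded)

decSubset : ∀ {n} {P : Fin n → Set} → Decidable P → Subset n
decSubset P? = tabulate (does ∘ P?)

module _ {n : ℕ} {P : Fin n → Set} (P? : Decidable P) where

  ∈-decSubset⁺ : ∀ {x} → P x → x ∈ˢ decSubset P?
  ∈-decSubset⁺ {x} px =
    lookup⇒[]= x _ (trans (lookup∘tabulate (does ∘ P?) x) (dec-true (P? x) px))

  ∈-decSubset⁻ : ∀ {x} → x ∈ˢ decSubset P? → P x
  ∈-decSubset⁻ {x} x∈ =
    yes⁻¹ (P? x) (trans (sym (lookup∘tabulate (does ∘ P?) x)) ([]=⇒lookup x∈))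
    where
    yes⁻¹ : ∀ {A : Set} (a? : Dec A) → does a? ≡ true → A
    yes⁻¹ (yes a) _ = a

enumerate : ∀ {n} (s : Subset n) → Fin ∣ s ∣ → Fin n
enumerate (inside  ∷ s) zero    = zero
enumerate (inside  ∷ s) (suc i) = suc (enumerate s i)
enumerate (outside ∷ s) i       = suc (enumerate s i)

enumerate-∈ : ∀ {n} (s : Subset n) i → enumerate s i ∈ˢ s
enumerate-∈ (inside  ∷ s) zero    = here
enumerate-∈ (inside  ∷ s) (suc i) = there (enumerate-∈ s i)
enumerate-∈ (outside ∷ s) i       = there (enumerate-∈ s i)

enumerate-injective : ∀ {n} (s : Subset n) → Injective _≡_ _≡_ (enumerate s)
enumerate-injective (inside  ∷ s) {zero}  {zero}  _  = refl
enumerate-injective (inside  ∷ s) {suc i} {suc j} eq = cong suc (enumerate-injective s (suc-injective eq))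
enumerate-injective (outside ∷ s)                 eq = enumerate-injective s (suc-injective eq)

injectiveOn⇒∣∣≤ : ∀ {n K} (s : Subset n) (f : Fin n → Fin K) →
                   (∀ {x y} → x ∈ˢ s → y ∈ˢ s → f x ≡ f y → x ≡ y) → ∣ s ∣ ≤ K
injectiveOn⇒∣∣≤ s f injectiveOn =
  injective⇒≤ (enumerate-injective s ∘ injectiveOn (enumerate-∈ s _) (enumerate-∈ s _))

anc-trans : ∀ {m} {p : Fin m → Maybe (Fin m)} {u v w d e} →
            Anc p u v d → Anc p v w e → Anc p u w (e + d)
anc-trans a here         = a
anc-trans a (there pw b) = there pw (anc-trans a b)

module Forest {m : ℕ} (F : RootedForest m) where

  _⪯_ : Fin m → Fin m → Set
  u ⪯ v = F ⊢ u ⪯ v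

  _≺_ : Fin m → Fin m → Set
  u ≺ v = F ⊢ u ≺ v

  ⪯-refl : ∀ {u} → u ⪯ u
  ⪯-refl = 0 , here

  ⪯-trans : ∀ {u v w} → u ⪯ v → v ⪯ w → u ⪯ w
  ⪯-trans (d , a) (e , b) = e + d , anc-trans a b

  anc-split : ∀ {u u′ v d e} →
              Anc (par F) u v d → Anc (par F) u′ v (d + e) → Anc (par F) u′ u e
  anc-split here         b             = b
  anc-split (there pv a) (there pv′ b) with trans (sym pv) pv′
  ... | refl = anc-split a b

  ⪯-linear : ∀ {u u′ v} → u ⪯ v → u′ ⪯ v → (u ⪯ u′) ⊎ (u′ ⪯ u)
  ⪯-linear {u} {u′} (d , a) (d′ , b) with ≤-total d d′
  ... | inj₁ d≤d′ = inj₂ (_ , anc-split a (subst (Anc (par F) u′ _) (sym (m+[n∸m]≡n d≤d′)) b))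
  ... | inj₂ d′≤d = inj₁ (_ , anc-split b (subst (Anc (par F) u _) (sym (m+[n∸m]≡n d′≤d)) a))

  root-anc-longest : ∀ {r v x d e} →
                     par F r ≡ nothing → Anc (par F) r v d → Anc (par F) x v e → e ≤ d
  root-anc-longest pr a            here          = z≤n
  root-anc-longest pr here         (there pv _)  with trans (sym pr) pv
  ... | ()
  root-anc-longest pr (there pv a) (there pv′ b) with trans (sym pv) pv′
  ... | refl = s≤s (root-anc-longest pr a b)

  root : Fin m → Fin m
  root v = proj₁ (rooted F v)

  root-isRoot : ∀ v → par F (root v) ≡ nothing
  root-isRoot v = proj₁ (proj₂ (rooted F v))

  depth : Fin m → ℕ
  depth v = proj₁ (proj₂ (proj₂ (rooted F v)))

  root-anc : ∀ v → Anc (par F) (root v) v (depth v)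
  root-anc v = proj₂ (proj₂ (proj₂ (rooted F v)))

  depth-anc : ∀ {u v d} → Anc (par F) u v d → depth v ≡ d + depth u
  depth-anc {u} {v} a = ≤-antisym
    (root-anc-longest (root-isRoot u) (anc-trans (root-anc u) a) (root-anc v))
    (root-anc-longest (root-isRoot v) (root-anc v) (anc-trans (root-anc u) a))

  depth-mono : ∀ {u v} → u ⪯ v → depth u ≤ depth v
  depth-mono {u} (d , a) = subst (depth u ≤_) (sym (depth-anc a)) (m≤n+m (depth u) d)

  depth-anc-suc : ∀ {u v d} → Anc (par F) u v (suc d) → depth u < depth v
  depth-anc-suc {u} {d = d} a = subst (depth u <_) (sym (depth-anc a)) (s≤s (m≤n+m (depth u) d))

  depth-strict : ∀ {u v} → u ≺ v → depth u < depth v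
  depth-strict ((zero  , here) , u≢v) = contradiction refl u≢v
  depth-strict ((suc d , a)    , _)   = depth-anc-suc a

  ⪯-antisym : ∀ {u v} → u ⪯ v → v ⪯ u → u ≡ v
  ⪯-antisym (zero  , here) _   = refl
  ⪯-antisym (suc d , a)    v⪯u = contradiction (depth-mono v⪯u) (<⇒≱ (depth-anc-suc a))

  depth-bounded : ∀ {q} → DepthAtMost F q → ∀ v → suc (depth v) ≤ q
  depth-bounded bounded v = bounded (root v) v (depth v) (root-isRoot v) (root-anc v)

  ⪯-root : ∀ {u v} → par F v ≡ nothing → u ⪯ v → u ≡ v
  ⪯-root pv (_ , here)         = refl
  ⪯-root pv (_ , there pv′ _) with trans (sym pv) pv′
  ... | ()

  ⪯-parent : ∀ {u v w} → par F v ≡ just w → u ⪯ v → u ≡ v ⊎ u ⪯ w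
  ⪯-parent pv (_ , here)        = inj₁ refl
  ⪯-parent pv (_ , there pv′ a) with trans (sym pv) pv′
  ... | refl = inj₂ (_ , a)

  private
    ⪯-dec-from-root : ∀ {r v d} → par F r ≡ nothing → Anc (par F) r v d → ∀ u → Dec (u ⪯ v)
    ⪯-dec-from-root {v = v} pr a u with u ≟ᶠ v
    ... | yes refl = yes ⪯-refl
    ⪯-dec-from-root pr here          u | no u≢v = no (u≢v ∘ ⪯-root pr)
    ⪯-dec-from-root pr (there pv a) u | no u≢v with ⪯-dec-from-root pr a u
    ... | yes u⪯w = yes (⪯-trans u⪯w (1 , there pv here))
    ... | no  u⋠w = no ([ u≢v , u⋠w ] ∘ ⪯-parent pv)

  _⪯?_ : ∀ u v → Dec (u ⪯ v)
  u ⪯? v = ⪯-dec-from-root (root-isRoot v) (root-anc v) u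

  _≺?_ : ∀ u v → Dec (u ≺ v)
  u ≺? v = (u ⪯? v) ×-dec ¬? (u ≟ᶠ v)

  ⪯-≺-trans : ∀ {u v w} → u ⪯ v → v ≺ w → u ≺ w
  ⪯-≺-trans u⪯v (v⪯w , v≢w) = ⪯-trans u⪯v v⪯w , λ { refl → v≢w (⪯-antisym v⪯w u⪯v) }

  ≺-asym : ∀ {u v} → u ≺ v → ¬ (v ⪯ u)
  ≺-asym (u⪯v , u≢v) v⪯u = u≢v (⪯-antisym u⪯v v⪯u)

  ≺-wellFounded : WellFounded _≺_
  ≺-wellFounded = measure-wellFounded depth depth-strict

  ⪯-greatest : ∀ {v} {P : Fin m → Set} → Decidable P → (∀ {x} → P x → x ⪯ v) →
               ∀ {a} → P a → ∃[ w ] (P w × ∀ x → P x → x ⪯ w)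
  ⪯-greatest {v} {P} P? P⇒⪯v pa with minimal R-wf R? P? pa
    where
    R : Fin m → Fin m → Set
    R x y = y ≺ x × x ⪯ v
    R? : ∀ x y → Dec (R x y)
    R? x y = (y ≺? x) ×-dec (x ⪯? v)
    R-wf : WellFounded R
    R-wf = measure-wellFounded (λ x → depth v ∸ depth x)
                               (λ (y≺x , x⪯v) → ∸-monoʳ-< (depth-strict y≺x) (depth-mono x⪯v))
  ... | w , pw , maximal = w , pw , below
    where
    below : ∀ x → P x → x ⪯ w
    below x px with ⪯-linear (P⇒⪯v px) (P⇒⪯v pw) | x ≟ᶠ w
    ... | inj₁ x⪯w | _      = x⪯w
    ... | inj₂ _   | yes refl = ⪯-refl
    ... | inj₂ w⪯x | no x≢w = contradiction (((w⪯x , x≢w ∘ sym)) , P⇒⪯v px) (maximal x px)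

module Induced {m n′ : ℕ} (F : RootedForest m) (e : Fin n′ → Fin m)
               (e-injective : Injective _≡_ _≡_ e) where

  open Forest F

  ParentSpec : Fin n′ → Maybe (Fin n′) → Set
  ParentSpec h nothing  = ∀ h′ → ¬ (e h′ ≺ e h)
  ParentSpec h (just w) = e w ≺ e h × (∀ h′ → e h′ ≺ e h → e h′ ⪯ e w)

  parentWithSpec : ∀ h → Σ (Maybe (Fin n′)) (ParentSpec h)
  parentWithSpec h with any? (λ h′ → e h′ ≺? e h)
  ... | no  none         = nothing , λ h′ h′≺h → none (h′ , h′≺h)
  ... | yes (h′ , h′≺h)
    with ⪯-greatest P? (λ { (_ , refl , x≺h) → proj₁ x≺h }) (h′ , refl , h′≺h)
    where
    P : Fin m → Set
    P x = ∃[ h″ ] (e h″ ≡ x × e h″ ≺ e h)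
    P? : Decidable P
    P? x = any? (λ h″ → (e h″ ≟ᶠ x) ×-dec (e h″ ≺? e h))
  ...   | _ , (w , refl , w≺h) , greatest =
          just w , w≺h , λ h″ h″≺h → greatest (e h″) (h″ , refl , h″≺h)

  parent : Fin n′ → Maybe (Fin n′)
  parent h = proj₁ (parentWithSpec h)

  parent-root : ∀ {h} → parent h ≡ nothing → ∀ h′ → ¬ (e h′ ≺ e h)
  parent-root {h} ph = subst (ParentSpec h) ph (proj₂ (parentWithSpec h))

  parent-≺ : ∀ {h w} → parent h ≡ just w → e w ≺ e h
  parent-≺ {h} ph = proj₁ (subst (ParentSpec h) ph (proj₂ (parentWithSpec h)))

  parent-greatest : ∀ {h w} → parent h ≡ just w → ∀ h′ → e h′ ≺ e h → e h′ ⪯ e w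
  parent-greatest {h} ph = proj₂ (subst (ParentSpec h) ph (proj₂ (parentWithSpec h)))

  ≺ᵉ-wellFounded : WellFounded (_≺_ on e)
  ≺ᵉ-wellFounded = On.wellFounded e ≺-wellFounded

  private
    rootedAcc : ∀ {h} → Acc (_≺_ on e) h → ∃[ r ] (parent r ≡ nothing × ∃[ d ] Anc parent r h d)
    rootedAcc {h} (acc rs) with parent h in ph
    ... | nothing = h , ph , 0 , here
    ... | just w  with rootedAcc (rs (parent-≺ ph))
    ...   | r , pr , d , a = r , pr , suc d , there ph a

  induced : RootedForest n′
  induced = record { par = parent ; rooted = λ h → rootedAcc (≺ᵉ-wellFounded h) }

  anc⇒⪯ : ∀ {h′ h d} → Anc parent h′ h d → e h′ ⪯ e h
  anc⇒⪯ here         = ⪯-refl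
  anc⇒⪯ (there ph a) = ⪯-trans (anc⇒⪯ a) (proj₁ (parent-≺ ph))

  anc-depth : ∀ {h′ h d} → Anc parent h′ h d → d + depth (e h′) ≤ depth (e h)
  anc-depth here         = ≤-refl
  anc-depth (there ph a) = ≤-trans (s≤s (anc-depth a)) (depth-strict (parent-≺ ph))

  induced-⪯⇒ : ∀ {h′ h} → induced ⊢ h′ ⪯ h → e h′ ⪯ e h
  induced-⪯⇒ (_ , a) = anc⇒⪯ a

  private
    ⪯⇒inducedAcc : ∀ {h} → Acc (_≺_ on e) h → ∀ {h′} → e h′ ⪯ e h → induced ⊢ h′ ⪯ h
    ⪯⇒inducedAcc {h} (acc rs) {h′} h′⪯h with h′ ≟ᶠ h
    ... | yes refl = 0 , here
    ... | no h′≢h with parent h in ph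
    ...   | nothing = contradiction (h′⪯h , h′≢h ∘ e-injective) (parent-root ph h′)
    ...   | just w
      with ⪯⇒inducedAcc (rs (parent-≺ ph)) (parent-greatest ph h′ (h′⪯h , h′≢h ∘ e-injective))
    ...     | d , a = suc d , there ph a

  ⪯⇒induced : ∀ {h′ h} → e h′ ⪯ e h → induced ⊢ h′ ⪯ h
  ⪯⇒induced {h = h} = ⪯⇒inducedAcc (≺ᵉ-wellFounded h)

  induced-depth : ∀ {q} → DepthAtMost F q → DepthAtMost induced q
  induced-depth bounded r h d _ a =
    ≤-trans (s≤s (≤-trans (m≤m+n d _) (anc-depth a))) (depth-bounded bounded (e h))

edge-≢ : ∀ (G : Graph) {u v} → Edge G u v → u ≢ v
edge-≢ G {u} uv refl with trans (sym uv) (irrefl G u)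
... | ()

module Cover {k : ℕ} {G : Graph} (C : PebbleForestCover k G) where

  open Forest (forest C)

  crossing-edge : ∀ {P : V G → Set} {z a b} → Walk (Edge G) P a b → z ⪯ b → ¬ (z ⪯ a) →
                  ∃₂ λ x y → P x × Edge G x y × x ≺ z × z ⪯ y
  crossing-edge (stop _) z⪯b z⋠a = contradiction z⪯b z⋠a
  crossing-edge {z = z} (step {b = a′} pa aa′ w) z⪯b z⋠a with z ⪯? a′
  ... | no z⋠a′ = crossing-edge w z⪯b z⋠a′
  ... | yes z⪯a′ with comparable C _ _ aa′
  ...   | inj₂ a′⪯a = contradiction (⪯-trans z⪯a′ a′⪯a) z⋠a
  ...   | inj₁ a⪯a′ with ⪯-linear a⪯a′ z⪯a′
  ...     | inj₂ z⪯a = contradiction z⪯a z⋠a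
  ...     | inj₁ a⪯z = _ , _ , pa , aa′ , (a⪯z , λ { refl → z⋠a ⪯-refl }) , z⪯a′

  -- x still holds its pebble when the play, going down the forest, reaches t.
  InBag : V G → V G → Set
  InBag x t = x ⪯ t × (∀ z → x ≺ z → z ⪯ t → peb C z ≢ peb C x)

  inBag? : ∀ x t → Dec (InBag x t)
  inBag? x t = (x ⪯? t) ×-dec all? (λ z → (x ≺? z) →-dec ((z ⪯? t) →-dec ¬? (peb C z ≟ᶠ peb C x)))

  inBag-peb-injective : ∀ {x y t} → InBag x t → InBag y t → peb C x ≡ peb C y → x ≡ y
  inBag-peb-injective {x} {y} (x⪯t , x-kept) (y⪯t , y-kept) px≡py with x ≟ᶠ y
  ... | yes x≡y = x≡y
  ... | no  x≢y with ⪯-linear x⪯t y⪯t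
  ...   | inj₁ x⪯y = contradiction (sym px≡py) (x-kept y (x⪯y , x≢y) y⪯t)
  ...   | inj₂ y⪯x = contradiction px≡py (y-kept x (y⪯x , x≢y ∘ sym) x⪯t)

  inBag-self : ∀ t → InBag t t
  inBag-self t = ⪯-refl , λ z t≺z z⪯t → contradiction z⪯t (≺-asym t≺z)

  inBag-anc : ∀ {x w t} → InBag x t → w ⪯ t → x ⪯ w → InBag x w
  inBag-anc (_ , x-kept) w⪯t x⪯w = x⪯w , λ z x≺z z⪯w → x-kept z x≺z (⪯-trans z⪯w w⪯t)

  edge-inBag : ∀ {x y t} → Edge G x y → x ⪯ t → t ⪯ y → InBag x t
  edge-inBag {x} {y} xy x⪯t t⪯y = x⪯t , λ z x≺z z⪯t →
    pebbling C x y z xy (⪯-trans x⪯t t⪯y , edge-≢ G xy) x≺z (⪯-trans z⪯t t⪯y) ∘ sym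

  bag : V G → Subset (n G)
  bag t = decSubset (λ x → inBag? x t)

  inBag⇒∈bag : ∀ {x t} → InBag x t → x ∈ˢ bag t
  inBag⇒∈bag {t = t} = ∈-decSubset⁺ (λ x → inBag? x t)

  ∈bag⇒inBag : ∀ {x t} → x ∈ˢ bag t → InBag x t
  ∈bag⇒inBag {t = t} = ∈-decSubset⁻ (λ x → inBag? x t)

  ∣bag∣≤k : ∀ t → ∣ bag t ∣ ≤ k
  ∣bag∣≤k t = injectiveOn⇒∣∣≤ (bag t) (peb C) λ x∈ y∈ →
    inBag-peb-injective (∈bag⇒inBag x∈) (∈bag⇒inBag y∈)

module AddRoot {m : ℕ} (F : RootedForest m) where

  par⁺ : Fin (suc m) → Maybe (Fin (suc m))
  par⁺ zero    = nothing
  par⁺ (suc v) = just (maybe suc zero (par F v))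

  par⁺-suc : ∀ {v w} → par F v ≡ just w → par⁺ (suc v) ≡ just (suc w)
  par⁺-suc pv = cong (just ∘ maybe suc zero) pv

  par⁺-root : ∀ {r} → par F r ≡ nothing → par⁺ (suc r) ≡ just zero
  par⁺-root pr = cong (just ∘ maybe suc zero) pr

  anc-suc : ∀ {u v d} → Anc (par F) u v d → Anc par⁺ (suc u) (suc v) d
  anc-suc here         = here
  anc-suc (there pv a) = there (par⁺-suc pv) (anc-suc a)

  withRoot : RootedForest (suc m)
  withRoot = record { par = par⁺ ; rooted = rooted⁺ }
    where
    rooted⁺ : ∀ v → ∃[ r ] (par⁺ r ≡ nothing × ∃[ d ] Anc par⁺ r v d)
    rooted⁺ zero    = zero , refl , 0 , here
    rooted⁺ (suc v) with rooted F v
    ... | r , pr , d , a = zero , refl , d + 1 , anc-trans (there (par⁺-root pr) here) (anc-suc a)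

  withRoot-root : ∀ r → par⁺ r ≡ nothing → r ≡ zero
  withRoot-root zero _ = refl

  withRoot-oneRoot : ∀ r r′ → par⁺ r ≡ nothing → par⁺ r′ ≡ nothing → r ≡ r′
  withRoot-oneRoot r r′ pr pr′ = trans (withRoot-root r pr) (sym (withRoot-root r′ pr′))

-- A tree decomposition needs a single tree, so the cover forest is hung below a fresh root with an empty bag.
treeDecomposition : ∀ {w G} → PebbleForestCover (suc w) G → TreeDecomposition w G
treeDecomposition {w} {G} C = record
  { m         = suc (n G)
  ; tree      = withRoot
  ; oneRoot   = withRoot-oneRoot
  ; bag       = bag⁺
  ; covers    = λ v → suc v , inBag⇒∈bag (inBag-self v)
  ; edgesIn   = edgesIn
  ; connected = connected
  ; width     = width
  }
  where
  open Forest (forest C)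
  open Cover C
  open AddRoot (forest C)

  bag⁺ : Fin (suc (n G)) → Subset (n G)
  bag⁺ zero    = ∅
  bag⁺ (suc t) = bag t

  BagWalk : V G → Fin (suc (n G)) → Fin (suc (n G)) → Set
  BagWalk x = Walk (TreeAdj withRoot) (λ s → x ∈ˢ bag⁺ s)

  climb : ∀ {x t d} → Anc (par (forest C)) x t d → InBag x t → BagWalk x (suc t) (suc x)
  climb here         x∈t = stop (inBag⇒∈bag x∈t)
  climb (there pt a) x∈t =
    step (inBag⇒∈bag x∈t) (inj₁ (par⁺-suc pt)) (climb a (inBag-anc x∈t (1 , there pt here) (_ , a)))

  climbFrom : ∀ {x t} → x ∈ˢ bag t → BagWalk x (suc t) (suc x)
  climbFrom x∈t with ∈bag⇒inBag x∈t
  ... | x-in@((_ , a) , _) = climb a x-in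

  edgesIn : ∀ u v → Edge G u v → ∃[ t ] (u ∈ˢ bag⁺ t × v ∈ˢ bag⁺ t)
  edgesIn u v uv with comparable C u v uv
  ... | inj₁ u⪯v = suc v , inBag⇒∈bag (edge-inBag uv u⪯v ⪯-refl) , inBag⇒∈bag (inBag-self v)
  ... | inj₂ v⪯u = suc u , inBag⇒∈bag (inBag-self u) , inBag⇒∈bag (edge-inBag vu v⪯u ⪯-refl)
    where vu = trans (Graph.sym G v u) uv

  connected : ∀ x t t′ → x ∈ˢ bag⁺ t → x ∈ˢ bag⁺ t′ → BagWalk x t t′
  connected x zero    _        x∈ _    = contradiction x∈ ∉⊥
  connected x (suc t) zero     _   x∈  = contradiction x∈ ∉⊥
  connected x (suc t) (suc t′) x∈t x∈t′ = walk-++ (climbFrom x∈t) (walk-reverse swap (climbFrom x∈t′))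

  width : ∀ t → ∣ bag⁺ t ∣ ≤ suc w
  width zero    = subst (_≤ suc w) (sym (∣⊥∣≡0 (n G))) z≤n
  width (suc t) = ∣bag∣≤k t

module Embedding {m m′ : ℕ} (F : RootedForest m) (p′ : Fin m′ → Maybe (Fin m′))
                 (e : Fin m → Fin m′) (par-commute : ∀ x → p′ (e x) ≡ Maybe.map e (par F x)) where

  anc-map : ∀ {u v d} → Anc (par F) u v d → Anc p′ (e u) (e v) d
  anc-map here         = here
  anc-map (there pv a) = there (trans (par-commute _) (cong (Maybe.map e) pv)) (anc-map a)

  root-map : ∀ {r} → par F r ≡ nothing → p′ (e r) ≡ nothing
  root-map {r} pr = trans (par-commute r) (cong (Maybe.map e) pr)

  root-unmap : ∀ {r} → p′ (e r) ≡ nothing → par F r ≡ nothing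
  root-unmap {r} pr with par F r | par-commute r
  ... | nothing | _  = refl
  ... | just _  | eq with trans (sym pr) eq
  ...   | ()

  parent-unmap : ∀ v {w′} → p′ (e v) ≡ just w′ → ∃[ w ] (w′ ≡ e w × par F v ≡ just w)
  parent-unmap v pv with par F v | par-commute v
  ... | nothing | eq with trans (sym pv) eq
  ...   | ()
  parent-unmap v pv | just w | eq with trans (sym pv) eq
  ...   | refl = w , refl , refl

  anc-unmap : ∀ {u′ v d} → Anc p′ u′ (e v) d → ∃[ u ] (u′ ≡ e u × Anc (par F) u v d)
  anc-unmap here = _ , refl , here
  anc-unmap {v = v} (there pv a) with parent-unmap v pv
  ... | w , refl , pw with anc-unmap a
  ...   | u , eq , b = u , eq , there pw b

  module _ (e-injective : Injective _≡_ _≡_ e) where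

    ⪯-reflect : ∀ {u v} → ∃[ d ] Anc p′ (e u) (e v) d → F ⊢ u ⪯ v
    ⪯-reflect (d , a) with anc-unmap a
    ... | _ , eq , b with e-injective eq
    ...   | refl = d , b

    ≺-reflect : ∀ {u v} → (∃[ d ] Anc p′ (e u) (e v) d) × e u ≢ e v → F ⊢ u ≺ v
    ≺-reflect (eu⪯ev , eu≢ev) = ⪯-reflect eu⪯ev , eu≢ev ∘ cong e

data SplitView (a b : ℕ) : Fin (a + b) → Set where
  left  : ∀ u → SplitView a b (u ↑ˡ b)
  right : ∀ v → SplitView a b (a ↑ʳ v)

splitView : ∀ a b x → SplitView a b x
splitView a b x with splitAt a x in eq
... | inj₁ u = subst (SplitView a b) (splitAt⁻¹-↑ˡ eq) (left u)
... | inj₂ v = subst (SplitView a b) (splitAt⁻¹-↑ʳ eq) (right v)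

module ForestSum {m m′ : ℕ} (F : RootedForest m) (F′ : RootedForest m′) where

  par⊕ : Fin (m + m′) → Maybe (Fin (m + m′))
  par⊕ x = [ Maybe.map (_↑ˡ m′) ∘ par F , Maybe.map (m ↑ʳ_) ∘ par F′ ] (splitAt m x)

  par⊕-↑ˡ : ∀ u → par⊕ (u ↑ˡ m′) ≡ Maybe.map (_↑ˡ m′) (par F u)
  par⊕-↑ˡ u rewrite splitAt-↑ˡ m u m′ = refl

  par⊕-↑ʳ : ∀ v → par⊕ (m ↑ʳ v) ≡ Maybe.map (m ↑ʳ_) (par F′ v)
  par⊕-↑ʳ v rewrite splitAt-↑ʳ m m′ v = refl

  module Left  = Embedding F  par⊕ (_↑ˡ m′) par⊕-↑ˡ
  module Right = Embedding F′ par⊕ (m ↑ʳ_) par⊕-↑ʳ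

  forest⊕ : RootedForest (m + m′)
  forest⊕ = record { par = par⊕ ; rooted = rooted⊕ }
    where
    rooted⊕ : ∀ x → ∃[ r ] (par⊕ r ≡ nothing × ∃[ d ] Anc par⊕ r x d)
    rooted⊕ x with splitView m m′ x
    ... | left u  with rooted F u
    ...   | r , pr , d , a = r ↑ˡ m′ , Left.root-map pr , d , Left.anc-map a
    rooted⊕ x | right v with rooted F′ v
    ...   | r , pr , d , a = m ↑ʳ r , Right.root-map pr , d , Right.anc-map a

  ≺-reflectˡ : ∀ {u u′} → forest⊕ ⊢ (u ↑ˡ m′) ≺ (u′ ↑ˡ m′) → F ⊢ u ≺ u′
  ≺-reflectˡ = Left.≺-reflect (↑ˡ-injective m′ _ _)

  ≺-reflectʳ : ∀ {v v′} → forest⊕ ⊢ (m ↑ʳ v) ≺ (m ↑ʳ v′) → F′ ⊢ v ≺ v′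
  ≺-reflectʳ = Right.≺-reflect (↑ʳ-injective m _ _)

  forest⊕-depth : ∀ {q} → DepthAtMost F q → DepthAtMost F′ q → DepthAtMost forest⊕ q
  forest⊕-depth bounded bounded′ r x d pr a with splitView m m′ x
  ... | left u  with Left.anc-unmap a
  ...   | r′ , refl , a′ = bounded r′ u d (Left.root-unmap pr) a′
  forest⊕-depth bounded bounded′ r x d pr a | right v with Right.anc-unmap a
  ...   | r′ , refl , a′ = bounded′ r′ v d (Right.root-unmap pr) a′

module _ {G H : Graph} where

  data Edge⊕ : V (G ⊕ H) → V (G ⊕ H) → Set where
    inG : ∀ {u u′} → Edge G u u′ → Edge⊕ (u ↑ˡ n H) (u′ ↑ˡ n H)
    inH : ∀ {v v′} → Edge H v v′ → Edge⊕ (n G ↑ʳ v) (n G ↑ʳ v′)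

  edge⊕ : ∀ {x y} → Edge (G ⊕ H) x y → Edge⊕ x y
  edge⊕ {x} {y} xy with splitView (n G) (n H) x | splitView (n G) (n H) y
  ... | left u  | left u′  rewrite splitAt-↑ˡ (n G) u (n H) | splitAt-↑ˡ (n G) u′ (n H) = inG xy
  ... | right v | right v′ rewrite splitAt-↑ʳ (n G) (n H) v | splitAt-↑ʳ (n G) (n H) v′ = inH xy
  ... | left u  | right v  rewrite splitAt-↑ˡ (n G) u (n H) | splitAt-↑ʳ (n G) (n H) v with () ← xy
  ... | right v | left u   rewrite splitAt-↑ʳ (n G) (n H) v | splitAt-↑ˡ (n G) u (n H) with () ← xy

cover⊕ : ∀ {k G H} → PebbleForestCover k G → PebbleForestCover k H → PebbleForestCover k (G ⊕ H)
cover⊕ {k} {G} {H} CG CH = record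
  { forest = forest⊕ ; peb = peb⊕ ; comparable = comparable⊕ ; pebbling = pebbling⊕ }
  where
  open ForestSum (forest CG) (forest CH)

  peb⊕ : V (G ⊕ H) → Fin k
  peb⊕ x = [ peb CG , peb CH ] (splitAt (n G) x)

  peb⊕-↑ˡ : ∀ u → peb⊕ (u ↑ˡ n H) ≡ peb CG u
  peb⊕-↑ˡ u rewrite splitAt-↑ˡ (n G) u (n H) = refl

  peb⊕-↑ʳ : ∀ v → peb⊕ (n G ↑ʳ v) ≡ peb CH v
  peb⊕-↑ʳ v rewrite splitAt-↑ʳ (n G) (n H) v = refl

  comparable⊕ : ∀ x y → Edge (G ⊕ H) x y → (forest⊕ ⊢ x ⪯ y) ⊎ (forest⊕ ⊢ y ⪯ x)
  comparable⊕ x y xy with edge⊕ {G} {H} xy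
  ... | inG {u} {u′} uu′ with comparable CG u u′ uu′
  ...   | inj₁ (d , a) = inj₁ (d , Left.anc-map a)
  ...   | inj₂ (d , a) = inj₂ (d , Left.anc-map a)
  comparable⊕ x y xy | inH {v} {v′} vv′ with comparable CH v v′ vv′
  ...   | inj₁ (d , a) = inj₁ (d , Right.anc-map a)
  ...   | inj₂ (d , a) = inj₂ (d , Right.anc-map a)

  pebbling⊕ : ∀ x y w → Edge (G ⊕ H) x y →
              forest⊕ ⊢ x ≺ y → forest⊕ ⊢ x ≺ w → forest⊕ ⊢ w ⪯ y → peb⊕ x ≢ peb⊕ w
  pebbling⊕ x y w xy x≺y x≺w (_ , w⪯y) with edge⊕ {G} {H} xy
  ... | inG {u} {u′} uu′ with Left.anc-unmap w⪯y
  ...   | w′ , refl , a rewrite peb⊕-↑ˡ u | peb⊕-↑ˡ w′ =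
    pebbling CG u u′ w′ uu′ (≺-reflectˡ x≺y) (≺-reflectˡ x≺w) (_ , a)
  pebbling⊕ x y w xy x≺y x≺w (_ , w⪯y) | inH {v} {v′} vv′ with Right.anc-unmap w⪯y
  ...   | w′ , refl , a rewrite peb⊕-↑ʳ v | peb⊕-↑ʳ w′ =
    pebbling CH v v′ w′ vv′ (≺-reflectʳ x≺y) (≺-reflectʳ x≺w) (_ , a)

𝒯-⊕ : ∀ {k q} → DisjointUnionClosed (𝒯 k q)
𝒯-⊕ G H (CG , boundedG) (CH , boundedH) =
  cover⊕ CG CH , ForestSum.forest⊕-depth (forest CG) (forest CH) boundedG boundedH

avoiding⇒¬injective : ∀ {K} {f : Fin (suc K) → Fin (suc K)} {t} →
                      (∀ i → t ≢ f i) → ¬ Injective _≡_ _≡_ f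
avoiding⇒¬injective {K} avoid f-injective =
  <⇒notInjective (n<1+n K) (f-injective ∘ punchOut-injective (avoid _) (avoid _))

pick : ∀ {c} → Subset (suc c) → Fin (suc c)
pick s with nonempty? s
... | yes (a , _) = a
... | no  _       = zero

pick-∈ : ∀ {c} {s : Subset (suc c)} → Nonempty s → pick s ∈ˢ s
pick-∈ {s = s} ne with nonempty? s
... | yes (_ , a∈s) = a∈s
... | no  empty     = contradiction ne empty

module GreedyColouring
  {n c : ℕ} (Conflict : Fin n → Fin n → Set) (conflict? : ∀ x y → Dec (Conflict x y))
  (rank : Fin n → ℕ) (conflict-rank : ∀ {x y} → Conflict x y → rank x < rank y)
  (fewConflicts : ∀ y (g : Fin (suc c) → Fin n) → (∀ i → Conflict (g i) y) → ¬ Injective _≡_ _≡_ g)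
  where

  Free : (Fin n → Fin (suc c)) → Fin n → Fin (suc c) → Set
  Free κ y a = ¬ (∃[ x ] (Conflict x y × κ x ≡ a))

  free? : ∀ κ y → Decidable (Free κ y)
  free? κ y a = ¬? (any? λ x → conflict? x y ×-dec (κ x ≟ᶠ a))

  freeColours : (Fin n → Fin (suc c)) → Fin n → Subset (suc c)
  freeColours κ y = decSubset (free? κ y)

  freeColours-nonempty : ∀ κ y → Nonempty (freeColours κ y)
  freeColours-nonempty κ y with any? (free? κ y)
  ... | yes (a , a-free) = a , ∈-decSubset⁺ (free? κ y) a-free
  ... | no  none         = ⊥-elim (fewConflicts y witness (proj₁ ∘ proj₂ ∘ used) witness-injective)
    where
    used : ∀ a → ∃[ x ] (Conflict x y × κ x ≡ a)
    used a = decidable-stable (any? λ x → conflict? x y ×-dec (κ x ≟ᶠ a)) (none ∘ (a ,_))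
    witness : Fin (suc c) → Fin n
    witness a = proj₁ (used a)
    witness-injective : Injective _≡_ _≡_ witness
    witness-injective {a} {b} eq =
      trans (sym (proj₂ (proj₂ (used a)))) (trans (cong κ eq) (proj₂ (proj₂ (used b))))

  freeColours-cong : ∀ {κ κ′ y} → (∀ x → Conflict x y → κ x ≡ κ′ x) →
                     freeColours κ y ≡ freeColours κ′ y
  freeColours-cong {κ} {κ′} {y} agree =
    tabulate-cong λ a → does-⇔ (mk⇔ (to a) (from a)) (free? κ y a) (free? κ′ y a)
    where
    to : ∀ a → Free κ y a → Free κ′ y a
    to a a-free (x , xy , κ′x≡a) = a-free (x , xy , trans (agree x xy) κ′x≡a)
    from : ∀ a → Free κ′ y a → Free κ y a
    from a a-free (x , xy , κx≡a) = a-free (x , xy , trans (sym (agree x xy)) κx≡a)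

  -- colour f is already final on every vertex of rank < f (colour-stable).
  colour : ℕ → Fin n → Fin (suc c)
  colour zero    _ = zero
  colour (suc f) y = pick (freeColours (colour f) y)

  colour-stable : ∀ f f′ y → rank y < f → rank y < f′ → colour f y ≡ colour f′ y
  colour-stable (suc f) (suc f′) y (s≤s r≤f) (s≤s r≤f′) = cong pick (freeColours-cong λ x xy →
    colour-stable f f′ x (<-≤-trans (conflict-rank xy) r≤f) (<-≤-trans (conflict-rank xy) r≤f′))

  colouring : Fin n → Fin (suc c)
  colouring y = colour (suc (rank y)) y

  colouring-proper : ∀ {x y} → Conflict x y → colouring x ≢ colouring y
  colouring-proper {x} {y} xy eq = colouring-free (x , xy , trans stable eq)
    where
    colouring-free : Free (colour (rank y)) y (colouring y)
    colouring-free = ∈-decSubset⁻ (free? _ y) (pick-∈ (freeColours-nonempty _ y))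
    stable : colour (rank y) x ≡ colouring x
    stable = colour-stable (rank y) (suc (rank x)) x (conflict-rank xy) (n<1+n (rank x))

module MinorCover {k′ : ℕ} {G H : Graph} (M : H ≼ G) (C : PebbleForestCover (suc k′) G) where

  open Forest (forest C)
  open Cover C
  open _≼_ M

  InBranch : V H → V G → Set
  InBranch h x = branch x ≡ just h

  inBranch? : ∀ h → Decidable (InBranch h)
  inBranch? h x = ≡-decᵐ _≟ᶠ_ (branch x) (just h)

  inBranch-functional : ∀ {h h′ x} → InBranch h x → InBranch h′ x → h ≡ h′
  inBranch-functional x∈h x∈h′ = just-injective (trans (sym x∈h) x∈h′)

  topWithSpec : ∀ h → ∃[ t ] (InBranch h t × ∀ x → InBranch h x → ¬ (x ≺ t))
  topWithSpec h = minimal ≺-wellFounded _≺?_ (inBranch? h) (proj₂ (nonempty h))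

  top : V H → V G
  top h = proj₁ (topWithSpec h)

  top-∈ : ∀ h → InBranch h (top h)
  top-∈ h = proj₁ (proj₂ (topWithSpec h))

  top-least : ∀ {h x} → InBranch h x → top h ⪯ x
  top-least {h} {x} x∈h with top h ⪯? x
  ... | yes top⪯x = top⪯x
  ... | no  top⋠x with crossing-edge (branchConnected h x (top h) x∈h (top-∈ h)) ⪯-refl top⋠x
  ...   | x′ , _ , x′∈h , _ , x′≺top , _ =
          contradiction x′≺top (proj₂ (proj₂ (topWithSpec h)) x′ x′∈h)

  top-injective : Injective _≡_ _≡_ top
  top-injective {h} {h′} eq = inBranch-functional (top-∈ h) (subst (InBranch h′) (sym eq) (top-∈ h′))

  open Induced (forest C) top top-injective

  comparableH : ∀ h h′ → Edge H h h′ → (induced ⊢ h ⪯ h′) ⊎ (induced ⊢ h′ ⪯ h)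
  comparableH h h′ hh′ with edgesRealised h h′ hh′
  ... | u , v , u∈h , v∈h′ , uv = Sum.map ⪯⇒induced ⪯⇒induced (tops-comparable (comparable C u v uv))
    where
    tops-comparable : (u ⪯ v) ⊎ (v ⪯ u) → (top h ⪯ top h′) ⊎ (top h′ ⪯ top h)
    tops-comparable (inj₁ u⪯v) = ⪯-linear (⪯-trans (top-least u∈h) u⪯v) (top-least v∈h′)
    tops-comparable (inj₂ v⪯u) = ⪯-linear (top-least u∈h) (⪯-trans (top-least v∈h′) v⪯u)

  Conflict : V H → V H → Set
  Conflict h′ h = h′ ≢ h × ∃[ x ] (InBranch h′ x × InBag x (top h))

  conflict? : ∀ h′ h → Dec (Conflict h′ h)
  conflict? h′ h = ¬? (h′ ≟ᶠ h) ×-dec any? (λ x → inBranch? h′ x ×-dec inBag? x (top h))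

  conflict-≺ : ∀ {h′ h} → Conflict h′ h → top h′ ≺ top h
  conflict-≺ {h′} {h} (h′≢h , x , x∈h′ , x⪯top , _) =
    ⪯-≺-trans (top-least x∈h′) (x⪯top , λ { refl → h′≢h (inBranch-functional x∈h′ (top-∈ h)) })

  fewConflicts : ∀ h (g : Fin (suc k′) → V H) → (∀ i → Conflict (g i) h) → ¬ Injective _≡_ _≡_ g
  fewConflicts h g conflicting g-injective =
    avoiding⇒¬injective {f = peb C ∘ x} avoids peb∘x-injective
    where
    x : Fin (suc k′) → V G
    x i = proj₁ (proj₂ (conflicting i))
    x∈g : ∀ i → InBranch (g i) (x i)
    x∈g i = proj₁ (proj₂ (proj₂ (conflicting i)))
    x-inBag : ∀ i → InBag (x i) (top h)
    x-inBag i = proj₂ (proj₂ (proj₂ (conflicting i)))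
    avoids : ∀ i → peb C (top h) ≢ peb C (x i)
    avoids i eq with inBag-peb-injective (x-inBag i) (inBag-self (top h)) (sym eq)
    ... | x≡top =
      proj₁ (conflicting i) (inBranch-functional (x∈g i) (subst (InBranch h) (sym x≡top) (top-∈ h)))
    peb∘x-injective : Injective _≡_ _≡_ (peb C ∘ x)
    peb∘x-injective {i} {j} eq with inBag-peb-injective (x-inBag i) (x-inBag j) eq
    ... | xi≡xj =
      g-injective (inBranch-functional (x∈g i) (subst (InBranch (g j)) (sym xi≡xj) (x∈g j)))

  open GreedyColouring Conflict conflict? (depth ∘ top) (depth-strict ∘ conflict-≺) fewConflicts

  conflict-from-edge : ∀ h h′ w → Edge H h h′ → top h ≺ top w → top w ⪯ top h′ → Conflict h w
  conflict-from-edge h h′ w hh′ top≺ ⪯top with edgesRealised h h′ hh′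
  ... | u , v , u∈h , v∈h′ , uv
    with crossing-edge walk (⪯-trans ⪯top (top-least v∈h′)) (≺-asym top≺)
    where
    walk : Walk (Edge G) (λ y → InBranch h y ⊎ y ≡ v) (top h) v
    walk = walk-snoc (walk-weaken inj₁ (branchConnected h (top h) u (top-∈ h) u∈h)) uv (inj₂ refl)
  ...   | _ , _ , inj₂ refl , _ , v≺top , _ =
          contradiction (⪯-trans ⪯top (top-least v∈h′)) (≺-asym v≺top)
  ...   | x , y , inj₁ x∈h , xy , x≺top , top⪯y =
          (λ { refl → ≺-asym top≺ ⪯-refl }) , x , x∈h , edge-inBag xy (proj₁ x≺top) top⪯y

  coverH : PebbleForestCover (suc k′) H
  coverH = record
    { forest = induced ; peb = colouring ; comparable = comparableH ; pebbling = pebblingH }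
    where
    pebblingH : ∀ h h′ w → Edge H h h′ →
                induced ⊢ h ≺ h′ → induced ⊢ h ≺ w → induced ⊢ w ⪯ h′ → colouring h ≢ colouring w
    pebblingH h h′ w hh′ _ (h⪯w , h≢w) w⪯h′ = colouring-proper
      (conflict-from-edge h h′ w hh′ (induced-⪯⇒ h⪯w , h≢w ∘ top-injective) (induced-⪯⇒ w⪯h′))

  𝒯-minor : ∀ {q} → DepthAtMost (forest C) q → 𝒯 (suc k′) q H
  𝒯-minor bounded = coverH , induced-depth bounded

𝒯-minorClosed : ∀ {k′ q} → MinorClosed (𝒯 (suc k′) q)
𝒯-minorClosed G H M (C , bounded) = MinorCover.𝒯-minor M C bounded

corollary3p5 : ∀ (k q : ℕ) → 1 ≤ k → 1 ≤ q →
    MinorClosed (𝒯 k q) × DisjointUnionClosed (𝒯 k q) ×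
    (∀ G → 𝒯 k q G → TreewidthAtMost (k ∸ 1) G × TreedepthAtMost q G)
corollary3p5 (suc k′) q _ _ =
  𝒯-minorClosed ,
  𝒯-⊕ ,
  λ G (C , bounded) → treeDecomposition C , (forest C , bounded , comparable C)
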